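{- For every $n\ge1$ and every $\pi\in\mathfrak{S}_n(2413,3142)$, we have $\mathsf{comp}(\pi)-1=\mathsf{top}(\eta(\pi))$.
   Context: $\mathfrak{S}_n(2413,3142)$ is the set of permutations of $[n]$ avoiding the patterns $2413$ and $3142$ (no subsequence order-isomorphic to either). For $\pi\in\mathfrak{S}_k,\sigma\in\mathfrak{S}_l$, the direct sum is $\pi\oplus\sigma=\pi_1\cdots\pi_k(\sigma_1+k)\cdots(\sigma_l+k)$ and the skew sum is $\pi\ominus\sigma=(\pi_1+l)\cdots(\pi_k+l)\sigma_1\cdots\sigma_l$. For $\pi\in\mathfrak{S}_n$, $\mathsf{comp}(\pi)=|\{i\in[n]:\pi_j\le i\text{ for all } j\le i\}|$. A di-sk tree is a rooted binary tree (each node has at most one left child and at most one right child) whose nodes are labeled $\oplus$ or $\ominus$, such that no node has the same label as its right child. $\mathfrak{DT}_n$ is the set of di-sk trees with $n-1$ nodes (for $n=1$ only the empty tree). The map $\eta:\mathfrak{S}_n(2413,3142)\to\mathfrak{DT}_n$ is defined recursively: $\eta(1)=\emptyset$; for $n\ge2$ let $i$ be the largest index in $[n-1]$ such that either $\min\{\pi_1,\dots,\pi_i\}>\max\{\pi_{i+1},\dots,\pi_n\}$ or $\max\{\pi_1,\dots,\pi_i\}<\min\{\pi_{i+1},\dots,\pi_n\}$ (such $i$ exists). In the first case $\pi=\omega\ominus\rho$ with $\omega\in\mathfrak{S}_i(2413,3142)$, $\rho\in\mathfrak{S}_{n-i}(2413,3142)$, and $\eta(\pi)$ is the tree with root labeled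 $\ominus$, left subtree $\eta(\omega)$ and right subtree $\eta(\rho)$; in the second case $\pi=\omega\oplus\rho$ and $\eta(\pi)$ is the tree with root labeled $\oplus$, left subtree $\eta(\omega)$ and right subtree $\eta(\rho)$. ($\eta$ is a bijection.) The inorder traversal of a tree visits recursively the left subtree, then the root, then the right subtree. The spine of a nonempty tree $T$ is the path from the root to the first node in inorder (i.e., the path obtained by repeatedly going to the left child starting from the root). $\mathsf{top}(T)$ is the number of consecutive $\oplus$-nodes at the top of the spine, starting from the root (so $\mathsf{top}(T)=0$ if the root is a $\ominus$-node, and $\mathsf{top}(\emptyset)=0$). -}

module Defs where

open import Data.Nat using (ℕ; zero; suc; _+_; _∸_; _≤_; _<_; _⊔_; _⊓_; _<ᵇ_; _≤ᵇ_)
open import Data.Bool using (Bool; true; false; if_then_else_; _∧_)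
open import Data.List as L using (List; []; _∷_; take; drop; length; foldr; filter; downFrom; upTo)
import Data.List.Relation.Unary.All as LAll
open import Data.List.Relation.Unary.Unique.Propositional using (Unique)
open import Data.Vec using (Vec; lookup; toList)
open import Data.Fin as F using (Fin)
open import Data.Product using (_×_; ∃; ∃-syntax)
open import Data.Maybe using (Maybe; just; nothing)
open import Relation.Binary.PropositionalEquality using (_≡_)
open import Relation.Nullary using (¬_)

IsPerm : (n : ℕ) → Vec ℕ n → Set
IsPerm n π = Unique (toList π) × LAll.All (λ x → 1 ≤ x × x ≤ n) (toList π)

Contains2413 : {n : ℕ} → Vec ℕ n → Set
Contains2413 {n} π = ∃[ i ] ∃[ j ] ∃[ k ] ∃[ l ]
  (i F.< j × j F.< k × k F.< l ×
   lookup π k < lookup π i × lookup π i < lookup π l × lookup π l < lookup π j)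

Contains3142 : {n : ℕ} → Vec ℕ n → Set
Contains3142 {n} π = ∃[ i ] ∃[ j ] ∃[ k ] ∃[ l ]
  (i F.< j × j F.< k × k F.< l ×
   lookup π j < lookup π l × lookup π l < lookup π i × lookup π i < lookup π k)

IsSep : (n : ℕ) → Vec ℕ n → Set
IsSep n π = IsPerm n π × ¬ Contains2413 π × ¬ Contains3142 π

-- comp(π) = |{ i ∈ [n] : π_j ≤ i for all j ≤ i }|

allB : {A : Set} → (A → Bool) → List A → Bool
allB p = foldr (λ x b → p x ∧ b) true

compL : List ℕ → ℕ
compL π = length (filter (λ i → Data.Bool._≟_ (allB (λ x → x ≤ᵇ i) (take i π)) true)
                         (L.map suc (upTo (length π))))
  where import Data.Bool

comp : {n : ℕ} → Vec ℕ n → ℕ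
comp π = compL (toList π)

data Label : Set where
  ⊕ ⊖ : Label

data Tree : Set where
  empty : Tree
  node  : Label → Tree → Tree → Tree

top : Tree → ℕ
top empty          = 0
top (node ⊕ l _)   = suc (top l)
top (node ⊖ _ _)   = 0

maxL : List ℕ → ℕ
maxL = foldr _⊔_ 0

minL : List ℕ → ℕ
minL []       = 0
minL (x ∷ xs) = foldr _⊓_ x xs

std : List ℕ → List ℕ
std π = L.map (λ x → suc (length (filter (λ y → y Data.Nat.<? x) π))) π
  where import Data.Nat

skewAt : List ℕ → ℕ → Bool
skewAt π i = maxL (drop i π) <ᵇ minL (take i π)

directAt : List ℕ → ℕ → Bool
directAt π i = maxL (take i π) <ᵇ minL (drop i π)

-- largest i ∈ [n-1] (searched from n-1 downwards) with a skew or direct split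
findSplit : List ℕ → List ℕ → Maybe ℕ
findSplit π []       = nothing
findSplit π (i ∷ is) =
  if skewAt π i then just i else if directAt π i then just i else findSplit π is

-- η with fuel (fuel = length suffices since both parts are strictly shorter)
etaF : ℕ → List ℕ → Tree
etaF zero       π = empty
etaF (suc fuel) π with findSplit π (L.map suc (downFrom (length π ∸ 1)))
... | nothing = empty
... | just i  =
  node (if skewAt π i then ⊖ else ⊕)
       (etaF fuel (std (take i π)))
       (etaF fuel (std (drop i π)))

eta : {n : ℕ} → Vec ℕ n → Tree
eta {n} π = etaF n (toList π)

-- A permutation of [n] has a direct split at i < n exactly when its first i entries are
-- {1,…,i}; both directions are pigeonhole arguments (distinct values squeezed into too short an
-- interval). Position n always counts, so comp π = 1 + (number of direct splits of π).
-- On the tree side, the last split found by η is either skew, and then π has no direct split at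
-- all, or direct at j, and then the direct splits of π are j together with those of π₁⋯π_j, which
-- standardisation preserves. The root of η π is ⊕ exactly in the second case, so top (η π) counts
-- the direct splits as well.
module Submission where

open import Defs
open import Data.Bool using (Bool; true; false; T; if_then_else_; _∧_)
import Data.Bool as Bool
open import Data.Empty using (⊥-elim)
open import Data.List as List using (List; []; _∷_; _++_; take; drop; length; filter; downFrom; upTo)
open import Data.List.Properties
  using ( foldr-preservesᵇ; foldr-forcesᵇ; foldr-preservesʳ; foldr-map; take-take; take-map; drop-map
        ; length-map; length-take; length-drop; length-++; take++drop≡id; take-all; map-++; upTo-∷ʳ
        ; filter-all; filter-accept; filter-reject; filter-++ )
open import Data.List.Membership.Propositional using (_∈_)
open import Data.List.Membership.Propositional.Properties
  using (∈-map⁺; ∈-map⁻; ∈-++⁺ʳ; ∈-++⁻; ∈-filter⁻)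
open import Data.List.Relation.Binary.Sublist.Propositional using (⊆-refl)
open import Data.List.Relation.Binary.Sublist.Propositional.Properties
  using (Any-resp-⊆; drop⁺; drop⁺-≥; take⁺; take-⊆; drop-⊆; filter⁺; length-mono-≤)
open import Data.List.Relation.Unary.All as All using (All; []; _∷_)
open import Data.List.Relation.Unary.All.Properties using (all⁺; all⁻)
open import Data.List.Relation.Unary.Any as Any using (Any; here; there)
open import Data.List.Relation.Unary.Unique.Propositional using (Unique; _∷_)
import Data.List.Relation.Unary.Unique.Propositional.Properties as Unique
open import Data.Maybe using (Maybe; just; nothing)
open import Data.Nat using (ℕ; zero; suc; _+_; _<_; _≤_; _∸_; _<ᵇ_; _≤ᵇ_; z≤n; s≤s)
open import Data.Nat.Properties
open import Data.Product using (_×_; _,_; ∃; ∃₂; proj₁; proj₂)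
open import Data.Sum using (_⊎_; inj₁; inj₂; fromInj₂)
open import Data.Vec using (Vec; toList)
open import Data.Vec.Properties using (length-toList)
open import Function using (_⇔_; mk⇔; Equivalence; _∘_)
import Function.Properties.Equivalence as ⇔
open import Relation.Binary.PropositionalEquality
open import Relation.Nullary using (¬_; Dec; contradiction; yes; no; ¬?)
open import Relation.Unary using (Decidable)

open Equivalence using (to; from)

T⇔T⇒≡ : ∀ {a b} → T a ⇔ T b → a ≡ b
T⇔T⇒≡ {false} {false} _ = refl
T⇔T⇒≡ {false} {true}  e = contradiction (from e _) λ ()
T⇔T⇒≡ {true}  {false} e = contradiction (to e _) λ ()
T⇔T⇒≡ {true}  {true}  _ = refl

≤∸1⇒< : ∀ {i n} → 1 ≤ i → i ≤ n ∸ 1 → i < n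
≤∸1⇒< {n = zero}  1≤i i≤0 = contradiction (≤-trans 1≤i i≤0) λ ()
≤∸1⇒< {n = suc n} _   i≤n = s≤s i≤n

<⇒≤∸1 : ∀ {i n} → i < n → i ≤ n ∸ 1
<⇒≤∸1 (s≤s i≤n) = i≤n

drop-nonEmpty : ∀ {i} (xs : List ℕ) → i < length xs → ∃₂ λ y ys → drop i xs ≡ y ∷ ys
drop-nonEmpty {zero}  (x ∷ xs) _         = x , xs , refl
drop-nonEmpty {suc i} (x ∷ xs) (s≤s i<n) = drop-nonEmpty xs i<n

∈-drop : ∀ {i} (xs : List ℕ) → i < length xs → ∃ λ y → y ∈ drop i xs
∈-drop xs i<n with drop-nonEmpty xs i<n
... | y , _ , eq = y , subst (y ∈_) (sym eq) (here refl)

∈-drop-≤ : ∀ {m n z} (xs : List ℕ) → m ≤ n → z ∈ drop n xs → z ∈ drop m xs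
∈-drop-≤ xs m≤n = Any-resp-⊆ (drop⁺-≥ {xs = xs} m≤n)

drop≡drop-take++drop : ∀ {i j} (xs : List ℕ) → i ≤ j → drop i xs ≡ drop i (take j xs) ++ drop j xs
drop≡drop-take++drop {zero}  {j}     xs       _         = sym (take++drop≡id j xs)
drop≡drop-take++drop {suc i} {suc j} []       _         = refl
drop≡drop-take++drop {suc i} {suc j} (x ∷ xs) (s≤s i≤j) = drop≡drop-take++drop xs i≤j

length-take-≤ : ∀ {j} (xs : List ℕ) → j ≤ length xs → length (take j xs) ≡ j
length-take-≤ {j} xs j≤n = trans (length-take j xs) (m≤n⇒m⊓n≡m j≤n)

module _ {A : Set} {P Q : A → Set} (P? : Decidable P) (Q? : Decidable Q) (P⇒Q : ∀ {z} → P z → Q z) where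

  length-filter-≤ : ∀ zs → length (filter P? zs) ≤ length (filter Q? zs)
  length-filter-≤ zs = length-mono-≤ (filter⁺ P? Q? {as = zs} (λ { refl → P⇒Q }) ⊆-refl)

  length-filter-< : ∀ {zs} → Any (λ z → Q z × ¬ P z) zs → length (filter P? zs) < length (filter Q? zs)
  length-filter-< {z ∷ zs} (here (qz , ¬pz)) with P? z | Q? z
  ... | yes pz | _      = contradiction pz ¬pz
  ... | no _   | yes _  = s≤s (length-filter-≤ zs)
  ... | no _   | no ¬qz = contradiction qz ¬qz
  length-filter-< {z ∷ zs} (there w) with P? z | Q? z | length-filter-< w
  ... | yes _  | yes _  | ih = s≤s ih
  ... | yes pz | no ¬qz | _  = contradiction (P⇒Q pz) ¬qz
  ... | no _   | yes _  | ih = m<n⇒m<1+n ih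
  ... | no _   | no _   | ih = ih

Unique-++⇒disjoint : ∀ (xs : List ℕ) {ys x y} → Unique (xs ++ ys) → x ∈ xs → y ∈ ys → x ≢ y
Unique-++⇒disjoint (z ∷ xs) (z∉ ∷ _) (here refl) y∈ = All.lookup z∉ (∈-++⁺ʳ xs y∈)
Unique-++⇒disjoint (z ∷ xs) (_ ∷ u)  (there x∈) y∈ = Unique-++⇒disjoint xs u x∈ y∈

infix 4 _≢?_
_≢?_ : (z m : ℕ) → Dec (z ≢ m)
z ≢? m = ¬? (z ≟ m)

length≤1+length-filter-≢ : ∀ m {xs} → Unique xs → length xs ≤ suc (length (filter (_≢? m) xs))
length≤1+length-filter-≢ m {[]}     _         = z≤n
length≤1+length-filter-≢ m {x ∷ xs} (x∉ ∷ u) with x ≟ m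
... | no x≢m   = s≤s (≤-trans (length≤1+length-filter-≢ m u)
                              (≤-reflexive (cong length (sym (filter-accept (_≢? m) x≢m)))))
... | yes refl = s≤s (≤-reflexive (cong length (sym x-removed)))
  where
  x-removed : filter (_≢? x) (x ∷ xs) ≡ xs
  x-removed = trans (filter-reject (_≢? x) (λ x≢x → x≢x refl)) (filter-all (_≢? x) (All.map ≢-sym x∉))

Unique-interval⇒length≤ : ∀ a k {xs} → Unique xs → (∀ {x} → x ∈ xs → a < x × x ≤ a + k) → length xs ≤ k
Unique-interval⇒length≤ a zero    {[]}    _ _      = z≤n
Unique-interval⇒length≤ a zero    {x ∷ _} _ bounds with bounds (here refl)
... | a<x , x≤a+0 = contradiction (<-≤-trans a<x (subst (x ≤_) (+-identityʳ a) x≤a+0)) (<-irrefl refl)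
Unique-interval⇒length≤ a (suc k) {xs} unique bounds =
  ≤-trans (length≤1+length-filter-≢ (a + suc k) unique)
          (s≤s (Unique-interval⇒length≤ a k (Unique.filter⁺ _ unique) bounds′))
  where
  bounds′ : ∀ {x} → x ∈ filter (_≢? a + suc k) xs → a < x × x ≤ a + k
  bounds′ {x} x∈ with ∈-filter⁻ (_≢? a + suc k) x∈
  ... | x∈xs , x≢top with bounds x∈xs
  ...   | a<x , x≤top = a<x , ≤-pred (subst (x <_) (+-suc a k) (≤∧≢⇒< x≤top x≢top))

infix 4 _≺_
_≺_ : List ℕ → List ℕ → Set
xs ≺ ys = ∀ {x y} → x ∈ xs → y ∈ ys → x < y

maxL<⇔ : ∀ {b x xs} → maxL (x ∷ xs) < b ⇔ All (_< b) (x ∷ xs)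
maxL<⇔ {b} {x} {xs} = mk⇔
  (foldr-forcesᵇ (λ m n lt → m⊔n<o⇒m<o m n lt , m⊔n<o⇒n<o m n lt) 0 (x ∷ xs))
  (λ { all@(x<b ∷ _) → foldr-preservesᵇ ⊔-pres-<m (≤-<-trans z≤n x<b) all })

<minL⇔ : ∀ {a y ys} → a < minL (y ∷ ys) ⇔ All (a <_) (y ∷ ys)
<minL⇔ {a} {y} {ys} = mk⇔
  (λ lt → <-≤-trans lt minL≤head
         ∷ foldr-forcesᵇ (λ m n lt → m<n⊓o⇒m<n m n lt , m<n⊓o⇒m<o m n lt) y ys lt)
  (λ { (a<y ∷ a<ys) → foldr-preservesᵇ ⊓-glb a<y a<ys })
  where
  minL≤head : minL (y ∷ ys) ≤ y
  minL≤head = foldr-preservesʳ {P = _≤ y} (λ z → ≤-trans (m⊓n≤n z _)) ≤-refl ys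

maxL<ᵇminL⇔≺ : ∀ {x xs y ys} → T (maxL (x ∷ xs) <ᵇ minL (y ∷ ys)) ⇔ (x ∷ xs) ≺ (y ∷ ys)
maxL<ᵇminL⇔≺ {x} {xs} {y} {ys} = mk⇔ to′ from′
  where
  to′ : T (maxL (x ∷ xs) <ᵇ minL (y ∷ ys)) → (x ∷ xs) ≺ (y ∷ ys)
  to′ lt x∈ y∈ = All.lookup (to <minL⇔ (All.lookup (to maxL<⇔ (<ᵇ⇒< _ _ lt)) x∈)) y∈
  from′ : (x ∷ xs) ≺ (y ∷ ys) → T (maxL (x ∷ xs) <ᵇ minL (y ∷ ys))
  from′ below = <⇒<ᵇ (from maxL<⇔ (All.tabulate λ x∈ → from <minL⇔ (All.tabulate (below x∈))))

directAt⇔≺ : ∀ {i} xs → 1 ≤ i → i < length xs → T (directAt xs i) ⇔ take i xs ≺ drop i xs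
directAt⇔≺ {suc i} (x ∷ xs) _ (s≤s i<n) with drop i xs | drop-nonEmpty xs i<n
... | _ | y , ys , refl = maxL<ᵇminL⇔≺

skewAt⇒≻ : ∀ {i} xs → 1 ≤ i → i < length xs → T (skewAt xs i) → drop i xs ≺ take i xs
skewAt⇒≻ {suc i} (x ∷ xs) _ (s≤s i<n) with drop i xs | drop-nonEmpty xs i<n
... | _ | y , ys , refl = to maxL<ᵇminL⇔≺

skewAt⇒¬directAt : ∀ {i j} xs → 1 ≤ i → i < length xs → 1 ≤ j → j < length xs →
                   T (skewAt xs j) → ¬ T (directAt xs i)
skewAt⇒¬directAt {suc i} {suc j} xs@(x ∷ _) 1≤i i<n 1≤j j<n skew direct
  with z , z∈ ← ∈-drop xs (⊔-lub i<n j<n) =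
  <-asym (to (directAt⇔≺ xs 1≤i i<n) direct (here refl) (∈-drop-≤ xs (m≤m⊔n (suc i) (suc j)) z∈))
         (skewAt⇒≻ xs 1≤j j<n skew (∈-drop-≤ xs (m≤n⊔m (suc i) (suc j)) z∈) (here refl))

directAt-take : ∀ {i j} xs → 1 ≤ i → i < j → j < length xs → T (directAt xs j) →
                directAt (take j xs) i ≡ directAt xs i
directAt-take {i} {j} xs 1≤i i<j j<n split = T⇔T⇒≡ (mk⇔
  (from (directAt⇔≺ xs 1≤i i<n) ∘ widen ∘ to (directAt⇔≺ (take j xs) 1≤i i<j′))
  (from (directAt⇔≺ (take j xs) 1≤i i<j′) ∘ narrow ∘ to (directAt⇔≺ xs 1≤i i<n)))
  where
  i≤j = <⇒≤ i<j
  i<n = <-trans i<j j<n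
  i<j′ : i < length (take j xs)
  i<j′ = subst (i <_) (sym (length-take-≤ xs (<⇒≤ j<n))) i<j
  take-take-≤ : take i (take j xs) ≡ take i xs
  take-take-≤ = trans (take-take i j xs) (cong (λ k → take k xs) (m≤n⇒m⊓n≡m i≤j))
  narrow : take i xs ≺ drop i xs → take i (take j xs) ≺ drop i (take j xs)
  narrow below x∈ y∈ =
    below (subst (_ ∈_) take-take-≤ x∈) (Any-resp-⊆ (drop⁺ (≤-refl {i}) (take-⊆ j xs)) y∈)
  widen : take i (take j xs) ≺ drop i (take j xs) → take i xs ≺ drop i xs
  widen below x∈ y∈ with ∈-++⁻ (drop i (take j xs)) (subst (_ ∈_) (drop≡drop-take++drop xs i≤j) y∈)
  ... | inj₁ y∈left  = below (subst (_ ∈_) (sym take-take-≤) x∈) y∈left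
  ... | inj₂ y∈right = to (directAt⇔≺ xs (≤-trans 1≤i i≤j) j<n) split (Any-resp-⊆ (take⁺ i≤j) x∈) y∈right

rank : List ℕ → ℕ → ℕ
rank ys x = suc (length (filter (_<? x) ys))

length-std : ∀ ys → length (std ys) ≡ length ys
length-std ys = length-map (rank ys) ys

rank-mono-≤ : ∀ ys {x y} → x ≤ y → rank ys x ≤ rank ys y
rank-mono-≤ ys x≤y = s≤s (length-filter-≤ (_<? _) (_<? _) (λ z<x → <-≤-trans z<x x≤y) ys)

rank-mono-< : ∀ {ys x y} → x ∈ ys → x < y → rank ys x < rank ys y
rank-mono-< x∈ x<y = s≤s (length-filter-< (_<? _) (_<? _) (λ z<x → <-trans z<x x<y)
                                          (Any.map (λ { refl → x<y , <-irrefl refl }) x∈))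

rank-cancel-< : ∀ ys {x y} → rank ys x < rank ys y → x < y
rank-cancel-< ys {x} {y} r< with x <? y
... | yes x<y = x<y
... | no x≮y  = contradiction r< (≤⇒≯ (rank-mono-≤ ys (≮⇒≥ x≮y)))

map-rank-≺⇔ : ∀ ys {t d} → (∀ {x} → x ∈ t → x ∈ ys) →
              List.map (rank ys) t ≺ List.map (rank ys) d ⇔ t ≺ d
map-rank-≺⇔ ys {t} {d} t⊆ys = mk⇔ unrank rerank
  where
  unrank : List.map (rank ys) t ≺ List.map (rank ys) d → t ≺ d
  unrank below x∈ y∈ = rank-cancel-< ys (below (∈-map⁺ (rank ys) x∈) (∈-map⁺ (rank ys) y∈))
  rerank : t ≺ d → List.map (rank ys) t ≺ List.map (rank ys) d
  rerank below rx∈ ry∈ with ∈-map⁻ (rank ys) rx∈ | ∈-map⁻ (rank ys) ry∈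
  ... | _ , x∈ , refl | _ , y∈ , refl = rank-mono-< (t⊆ys x∈) (below x∈ y∈)

directAt-std : ∀ {i} ys → 1 ≤ i → i < length ys → directAt (std ys) i ≡ directAt ys i
directAt-std {i} ys 1≤i i<n = T⇔T⇒≡
  (⇔.trans (directAt⇔≺ (std ys) 1≤i i<n′) (⇔.trans ≺-std⇔ (⇔.sym (directAt⇔≺ ys 1≤i i<n))))
  where
  i<n′ : i < length (std ys)
  i<n′ = subst (i <_) (sym (length-std ys)) i<n
  ≺-std⇔ : take i (List.map (rank ys) ys) ≺ drop i (List.map (rank ys) ys) ⇔ take i ys ≺ drop i ys
  ≺-std⇔ rewrite take-map {f = rank ys} i ys | drop-map {f = rank ys} i ys =
    map-rank-≺⇔ ys (Any-resp-⊆ (take-⊆ i ys))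

count : (ℕ → Bool) → ℕ → ℕ
count p zero    = zero
count p (suc k) = if p (suc k) then suc (count p k) else count p k

AllFalse : (ℕ → Bool) → ℕ → ℕ → Set
AllFalse p j k = ∀ {i} → j < i → i ≤ k → ¬ T (p i)

AllFalse-empty : ∀ {k} p → AllFalse p k k
AllFalse-empty p k<i i≤k = contradiction i≤k (<⇒≱ k<i)

AllFalse-suc : ∀ {p j k} → ¬ T (p (suc k)) → AllFalse p j k → AllFalse p j (suc k)
AllFalse-suc ¬t allFalse j<i i≤1+k with m≤n⇒m<n∨m≡n i≤1+k
... | inj₁ (s≤s i≤k) = allFalse j<i i≤k
... | inj₂ refl      = ¬t

count-cong : ∀ {p q} k → (∀ {i} → 1 ≤ i → i ≤ k → p i ≡ q i) → count p k ≡ count q k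
count-cong zero          _   = refl
count-cong {q = q} (suc k) p≗q rewrite p≗q (s≤s z≤n) (≤-refl {suc k}) =
  cong (λ c → if q (suc k) then suc c else c) (count-cong k λ 1≤i i≤k → p≗q 1≤i (m≤n⇒m≤1+n i≤k))

count-true : ∀ {p} k → T (p (suc k)) → count p (suc k) ≡ suc (count p k)
count-true {p} k t with p (suc k)
... | true = refl

count-AllFalse : ∀ {p j} k → j ≤ k → AllFalse p j k → count p k ≡ count p j
count-AllFalse zero z≤n _ = refl
count-AllFalse {p} (suc k) j≤1+k allFalse with m≤n⇒m<n∨m≡n j≤1+k
... | inj₂ refl      = refl
... | inj₁ (s≤s j≤k) with p (suc k) | allFalse (s≤s j≤k) ≤-refl
...   | true  | ¬t = contradiction _ ¬t
...   | false | _  = count-AllFalse k j≤k λ j<i i≤k → allFalse j<i (m≤n⇒m≤1+n i≤k)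

length-filter-upTo : ∀ p k → length (filter (λ i → p i Bool.≟ true) (List.map suc (upTo k))) ≡ count p k
length-filter-upTo p zero    = refl
length-filter-upTo p (suc k) = begin
  length (filter p? (List.map suc (upTo (suc k))))
    ≡⟨ cong (length ∘ filter p? ∘ List.map suc) (upTo-∷ʳ k) ⟨
  length (filter p? (List.map suc (upTo k ++ k ∷ [])))
    ≡⟨ cong (length ∘ filter p?) (map-++ suc (upTo k) (k ∷ [])) ⟩
  length (filter p? (List.map suc (upTo k) ++ suc k ∷ []))
    ≡⟨ cong length (filter-++ p? (List.map suc (upTo k)) (suc k ∷ [])) ⟩
  length (filter p? (List.map suc (upTo k)) ++ filter p? (suc k ∷ []))
    ≡⟨ length-++ (filter p? (List.map suc (upTo k))) ⟩
  length (filter p? (List.map suc (upTo k))) + length (filter p? (suc k ∷ []))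
    ≡⟨ cong (_+ length (filter p? (suc k ∷ []))) (length-filter-upTo p k) ⟩
  count p k + length (filter p? (suc k ∷ []))
    ≡⟨ last-step ⟩
  count p (suc k) ∎
  where
  open ≡-Reasoning
  p? = λ i → p i Bool.≟ true
  last-step : count p k + length (filter p? (suc k ∷ [])) ≡ count p (suc k)
  last-step with p (suc k)
  ... | true  = +-comm (count p k) 1
  ... | false = +-identityʳ (count p k)

data SplitSearch (xs : List ℕ) (k : ℕ) : Maybe ℕ → Set where
  noSplit   : AllFalse (directAt xs) 0 k → SplitSearch xs k nothing
  lastSplit : ∀ {j} → 1 ≤ j → j ≤ k → T (skewAt xs j) ⊎ T (directAt xs j) →
              AllFalse (directAt xs) j k → SplitSearch xs k (just j)

SplitSearch-suc : ∀ {xs k m} → ¬ T (directAt xs (suc k)) → SplitSearch xs k m → SplitSearch xs (suc k) m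
SplitSearch-suc ¬t (noSplit none)                  = noSplit (AllFalse-suc ¬t none)
SplitSearch-suc ¬t (lastSplit 1≤j j≤k split above) =
  lastSplit 1≤j (m≤n⇒m≤1+n j≤k) split (AllFalse-suc ¬t above)

findSplit-spec : ∀ xs k → SplitSearch xs k (findSplit xs (List.map suc (downFrom k)))
findSplit-spec xs zero = noSplit (AllFalse-empty (directAt xs))
findSplit-spec xs (suc k) with skewAt xs (suc k) in skew
... | true = lastSplit (s≤s z≤n) ≤-refl (inj₁ (subst T (sym skew) _)) (AllFalse-empty (directAt xs))
... | false with directAt xs (suc k) in direct
...   | true  = lastSplit (s≤s z≤n) ≤-refl (inj₂ (subst T (sym direct) _)) (AllFalse-empty (directAt xs))
...   | false = SplitSearch-suc (subst T direct) (findSplit-spec xs k)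

directSplits : List ℕ → ℕ
directSplits xs = count (directAt xs) (length xs ∸ 1)

directSplits-lastDirect : ∀ {j} xs → 1 ≤ j → j < length xs → T (directAt xs j) →
                          AllFalse (directAt xs) j (length xs ∸ 1) →
                          directSplits xs ≡ suc (directSplits (std (take j xs)))
directSplits-lastDirect {suc j} xs 1≤j j<n direct above = begin
  count (directAt xs) (length xs ∸ 1)  ≡⟨ count-AllFalse _ (<⇒≤∸1 j<n) above ⟩
  count (directAt xs) (suc j)          ≡⟨ count-true j direct ⟩
  suc (count (directAt xs) j)          ≡⟨ cong suc (count-cong j directAt-prefix) ⟩
  suc (count (directAt prefix) j)      ≡⟨ cong (λ n → suc (count (directAt prefix) (n ∸ 1)))
                                                 length-prefix ⟨
  suc (directSplits prefix)            ∎
  where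
  open ≡-Reasoning
  prefix = std (take (suc j) xs)
  length-take-j : length (take (suc j) xs) ≡ suc j
  length-take-j = length-take-≤ xs (<⇒≤ j<n)
  length-prefix : length prefix ≡ suc j
  length-prefix = trans (length-std (take (suc j) xs)) length-take-j
  directAt-prefix : ∀ {i} → 1 ≤ i → i ≤ j → directAt xs i ≡ directAt prefix i
  directAt-prefix {i} 1≤i i≤j = begin
    directAt xs i                 ≡⟨ directAt-take xs 1≤i (s≤s i≤j) j<n direct ⟨
    directAt (take (suc j) xs) i  ≡⟨ directAt-std (take (suc j) xs) 1≤i i<j′ ⟨
    directAt prefix i             ∎
    where
    i<j′ : i < length (take (suc j) xs)
    i<j′ = subst (i <_) (sym length-take-j) (s≤s i≤j)

top-etaF : ∀ f xs → length xs ≤ f → top (etaF f xs) ≡ directSplits xs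
top-etaF zero    []  _      = refl
top-etaF (suc f) xs n≤1+f
  with findSplit xs (List.map suc (downFrom (length xs ∸ 1))) | findSplit-spec xs (length xs ∸ 1)
... | nothing | noSplit none = sym (count-AllFalse _ z≤n none)
... | just j  | lastSplit 1≤j j≤n∸1 split above with skewAt xs j in skew
...   | true  = sym (count-AllFalse _ z≤n λ 1≤i i≤n∸1 →
                  skewAt⇒¬directAt xs 1≤i (≤∸1⇒< 1≤i i≤n∸1) 1≤j j<n (subst T (sym skew) _))
  where j<n = ≤∸1⇒< 1≤j j≤n∸1
...   | false = trans (cong suc (top-etaF f (std (take j xs)) prefix≤f))
                      (sym (directSplits-lastDirect xs 1≤j j<n (fromInj₂ ⊥-elim split) above))
  where
  j<n = ≤∸1⇒< 1≤j j≤n∸1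
  prefix≤f : length (std (take j xs)) ≤ f
  prefix≤f = begin
    length (std (take j xs))  ≡⟨ length-std (take j xs) ⟩
    length (take j xs)        ≡⟨ length-take-≤ xs (<⇒≤ j<n) ⟩
    j                         ≤⟨ j≤n∸1 ⟩
    length xs ∸ 1             ≤⟨ ∸-monoˡ-≤ 1 n≤1+f ⟩
    f                         ∎
    where open ≤-Reasoning

Permutation : List ℕ → Set
Permutation xs = Unique xs × All (λ x → 1 ≤ x × x ≤ length xs) xs

bounded⇔≺ : ∀ {i xs} → Permutation xs → i ≤ length xs → All (_≤ i) (take i xs) ⇔ take i xs ≺ drop i xs
bounded⇔≺ {i} {xs} (unique , inRange) i≤n = mk⇔ bounded⇒≺ ≺⇒bounded
  where
  n = length xs
  range : ∀ {x} → x ∈ xs → 1 ≤ x × x ≤ n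
  range = All.lookup inRange
  disjoint : ∀ {x y} → x ∈ take i xs → y ∈ drop i xs → x ≢ y
  disjoint = Unique-++⇒disjoint (take i xs) (subst Unique (sym (take++drop≡id i xs)) unique)
  bounded⇒≺ : All (_≤ i) (take i xs) → take i xs ≺ drop i xs
  bounded⇒≺ bounded {x} {y} x∈ y∈ = ≤-<-trans (All.lookup bounded x∈) i<y
    where
    y∉ : All (y ≢_) (take i xs)
    y∉ = All.tabulate λ x∈ → ≢-sym (disjoint x∈ y∈)
    i<y : i < y
    i<y with y ≤? i
    ... | no y≰i  = ≰⇒> y≰i
    ... | yes y≤i = contradiction (subst (_≤ i) (cong suc (length-take-≤ xs i≤n))
        (Unique-interval⇒length≤ 0 i (y∉ ∷ Unique.take⁺ i unique)
          λ { (here refl) → proj₁ (range (Any-resp-⊆ (drop-⊆ i xs) y∈)) , y≤i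
            ; (there z∈)  → proj₁ (range (Any-resp-⊆ (take-⊆ i xs) z∈)) , All.lookup bounded z∈ }))
        (<-irrefl refl)
  ≺⇒bounded : take i xs ≺ drop i xs → All (_≤ i) (take i xs)
  ≺⇒bounded below = All.tabulate x≤i
    where
    x≤i : ∀ {x} → x ∈ take i xs → x ≤ i
    x≤i {x} x∈ with x ≤? i
    ... | yes x≤i = x≤i
    ... | no x≰i  = contradiction (subst (_≤ n ∸ x) (length-drop i xs)
        (Unique-interval⇒length≤ x (n ∸ x) (Unique.drop⁺ i unique)
          λ y∈ → below x∈ y∈
               , subst (_ ≤_) (sym (m+[n∸m]≡n x≤n)) (proj₂ (range (Any-resp-⊆ (drop-⊆ i xs) y∈)))))
        (<⇒≱ (∸-monoʳ-< (≰⇒> x≰i) x≤n))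
      where x≤n = proj₂ (range (Any-resp-⊆ (take-⊆ i xs) x∈))

prefixBounded : List ℕ → ℕ → Bool
prefixBounded xs i = allB (_≤ᵇ i) (take i xs)

T-allB⇔All : ∀ (p : ℕ → Bool) ys → T (allB p ys) ⇔ All (T ∘ p) ys
T-allB⇔All p ys rewrite sym (foldr-map _∧_ p true ys) = mk⇔ (all⁺ p ys) (all⁻ p)

T-prefixBounded⇔ : ∀ xs i → T (prefixBounded xs i) ⇔ All (_≤ i) (take i xs)
T-prefixBounded⇔ xs i =
  ⇔.trans (T-allB⇔All (_≤ᵇ i) (take i xs)) (mk⇔ (All.map (≤ᵇ⇒≤ _ i)) (All.map ≤⇒≤ᵇ))

prefixBounded≡directAt : ∀ {i xs} → Permutation xs → 1 ≤ i → i < length xs →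
                         prefixBounded xs i ≡ directAt xs i
prefixBounded≡directAt {i} {xs} perm 1≤i i<n = T⇔T⇒≡
  (⇔.trans (T-prefixBounded⇔ xs i) (⇔.trans (bounded⇔≺ perm (<⇒≤ i<n)) (⇔.sym (directAt⇔≺ xs 1≤i i<n))))

compL≡suc-directSplits : ∀ xs → Permutation xs → 1 ≤ length xs → compL xs ≡ suc (directSplits xs)
compL≡suc-directSplits []            _    ()
compL≡suc-directSplits xs@(_ ∷ xs′) perm _ = begin
  compL xs                                     ≡⟨ length-filter-upTo (prefixBounded xs) (length xs) ⟩
  count (prefixBounded xs) (suc (length xs′))  ≡⟨ count-true (length xs′) boundedByLength ⟩
  suc (count (prefixBounded xs) (length xs′))  ≡⟨ cong suc (count-cong (length xs′) λ 1≤i i≤n∸1 →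
                                                    prefixBounded≡directAt perm 1≤i (s≤s i≤n∸1)) ⟩
  suc (directSplits xs)                        ∎
  where
  open ≡-Reasoning
  boundedByLength : T (prefixBounded xs (length xs))
  boundedByLength = from (T-prefixBounded⇔ xs (length xs))
    (subst (All (_≤ length xs)) (sym (take-all (length xs) xs ≤-refl)) (All.map proj₂ (proj₂ perm)))

lemma2p2 : (n : ℕ) → 1 ≤ n → (π : Vec ℕ n) → IsSep n π →
           comp π ∸ 1 ≡ top (eta π)
lemma2p2 n 1≤n π ((unique , inRange) , _) = begin
  comp π ∸ 1               ≡⟨ cong (_∸ 1) (compL≡suc-directSplits (toList π) perm 1≤length) ⟩
  directSplits (toList π)  ≡⟨ top-etaF n (toList π) (≤-reflexive n≡) ⟨
  top (eta π)              ∎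
  where
  open ≡-Reasoning
  n≡ : length (toList π) ≡ n
  n≡ = length-toList π
  1≤length : 1 ≤ length (toList π)
  1≤length = subst (1 ≤_) (sym n≡) 1≤n
  perm : Permutation (toList π)
  perm = unique , subst (λ m → All (λ x → 1 ≤ x × x ≤ m) (toList π)) (sym n≡) inRange
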